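{- For all positive integers $n$, $c_b(Q_n)=1$.
   Context: Bridge-burning Cops and Robbers is played on a finite graph $G$ by a team of cops and a single robber, with full information. First each cop chooses a starting vertex (several cops may share a vertex), then the robber chooses a starting vertex. The game then proceeds in rounds; in each round, first every cop either stays put or moves along an edge of the current graph to an adjacent vertex, and then the robber either stays put or moves along an edge of the current graph. Every edge traversed by the robber is immediately deleted from the graph (cop moves delete nothing). The cops win if at some moment some cop occupies the same vertex as the robber; the robber wins if he avoids this forever. $c_b(G)$ is the minimum number of cops for which the cops have a winning strategy. $Q_n$ is the $n$-dimensional hypercube, with vertex set $\{0,1\}^n$ and two vertices adjacent iff they differ in exactly one coordinate. -}

module Defs where

open import Data.Nat using (ℕ; zero; suc; _+_; _<_)
open import Data.Bool using (Bool; _xor_; if_then_else_)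
open import Data.Fin using (Fin)
open import Data.Vec using (Vec; []; _∷_; lookup)
open import Data.List using (List; []; _∷_)
open import Data.List.Membership.Propositional using (_∈_)
open import Data.Product using (Σ; ∃; _×_; _,_)
open import Data.Sum using (_⊎_)
open import Relation.Binary.PropositionalEquality using (_≡_)
open import Relation.Nullary using (¬_)

record Graph : Set₁ where
  field
    V   : Set
    Adj : V → V → Set

hamming : ∀ {n} → Vec Bool n → Vec Bool n → ℕ
hamming []       []       = 0
hamming (x ∷ xs) (y ∷ ys) = (if x xor y then 1 else 0) + hamming xs ys

Q : ℕ → Graph
Q n = record { V = Vec Bool n ; Adj = λ u v → hamming u v ≡ 1 }

module Game (G : Graph) where
  open Graph G

  -- Deleted edges are recorded as a list of ordered pairs; an edge {u,v}
  -- is deleted iff (u,v) or (v,u) occurs in the list.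
  Deleted : Set
  Deleted = List (V × V)

  Present : Deleted → V → V → Set
  Present D u v = Adj u v × ¬ ((u , v) ∈ D) × ¬ ((v , u) ∈ D)

  StepOrStay : Deleted → V → V → Set
  StepOrStay D u v = u ≡ v ⊎ Present D u v

  CopMoves : ∀ {k} → Deleted → Vec V k → Vec V k → Set
  CopMoves D cs cs' = ∀ i → StepOrStay D (lookup cs i) (lookup cs' i)

  data RMove (D : Deleted) (r : V) : V → Deleted → Set where
    stay : RMove D r r D
    go   : ∀ {r'} → Present D r r' → RMove D r r' ((r , r') ∷ D)

  Captured : ∀ {k} → Vec V k → V → Set
  Captured cs r = ∃ λ i → lookup cs i ≡ r

  -- Cops (to move) have a winning strategy from the position
  -- (deleted edges D, cop positions cs, robber position r).
  -- Inductive = the cops force a capture in finitely many rounds.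
  data CopWin {k : ℕ} (D : Deleted) (cs : Vec V k) (r : V) : Set where
    win : (cs' : Vec V k) → CopMoves D cs cs' →
          (Captured cs' r ⊎
           (∀ r' D' → RMove D r r' D' → Captured cs' r' ⊎ CopWin D' cs' r')) →
          CopWin D cs r

  CopsWin : ℕ → Set
  CopsWin k = Σ (Vec V k) λ cs → ∀ r → Captured cs r ⊎ CopWin [] cs r

BridgeBurningCopNumberIs : Graph → ℕ → Set
BridgeBurningCopNumberIs G m = CopsWin m × (∀ k → k < m → ¬ CopsWin k)
  where open Game G

module Submission where

-- Lower bound: without cops the robber simply stays put forever, so zero cops
-- never win on a graph with at least one vertex.
--
-- Upper bound: one cop chases the robber coordinate by coordinate.  Whenever
-- the robber is to move, every burnt edge lies in the subcube of vertices that
-- agree with the robber on all coordinates where the cop still disagrees with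
-- him ('Confined').  So while the two are apart the cop's vertex meets no burnt
-- edge and she can move along any coordinate.  She answers a robber who stays
-- by fixing one disagreement, and a robber who moved along coordinate j by
-- moving along j as well if they agreed there, and otherwise by fixing some
-- disagreement ('chase'); either answer preserves the invariant ('Follows').
-- Each round strictly decreases the potential "number of unburnt ordered
-- vertex pairs + Hamming distance", which yields the inductive 'CopWin'.

open import Defs
open import Data.Nat using (ℕ; _≤_)

open import Data.Nat using (zero; suc; pred; _+_; _<_; z≤n; s≤s)
open import Data.Nat.Properties
  using (≤-refl; m≤n⇒m≤1+n; +-mono-≤; +-mono-<-≤; +-mono-≤-<; +-monoʳ-<)
open import Data.Nat.Induction using (<-wellFounded)
open import Induction.WellFounded using (Acc; acc)
open import Data.Bool using (Bool; true; false; not; _xor_; if_then_else_)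
open import Data.Bool.Properties using (¬-not) renaming (_≟_ to _≟ᵇ_)
open import Data.Fin using (Fin) renaming (_≟_ to _≟ᶠ_)
import Data.Fin as Fin
open import Data.Vec using (Vec; []; _∷_; [_]; lookup; updateAt; replicate)
open import Data.Vec.Properties using (lookup∘updateAt; lookup∘updateAt′; ≡-dec)
open import Data.List using (List; cartesianProduct; cartesianProductWith)
import Data.List as List
open import Data.List.Membership.Propositional using (_∈_; _∉_)
open import Data.List.Membership.Propositional.Properties
  using (∈-cartesianProduct⁺; ∈-cartesianProductWith⁺)
open import Data.List.Relation.Unary.Any using (here; there)
open import Data.List.Relation.Binary.Subset.Propositional using (_⊆_)
open import Data.Product using (∃; _×_; _,_; proj₁; proj₂)
import Data.Product.Properties as Product
open import Data.Sum using (_⊎_; inj₁; inj₂)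
open import Data.Empty using (⊥-elim)
open import Function using (_∘_)
open import Relation.Nullary using (¬_; yes; no)
open import Relation.Binary.Definitions using (DecidableEquality)
open import Relation.Binary.PropositionalEquality
  using (_≡_; _≢_; refl; sym; trans; cong)

module _ (G : Graph) where
  open Game G

  robberSurvivesZeroCops : ∀ {D r} → ¬ CopWin {0} D [] r
  robberSurvivesZeroCops (win [] _ (inj₁ (() , _)))
  robberSurvivesZeroCops {D} {r} (win [] _ (inj₂ respond)) with respond r D stay
  ... | inj₁ (() , _)
  ... | inj₂ w = robberSurvivesZeroCops w

  zeroCopsLose : Graph.V G → ¬ CopsWin 0
  zeroCopsLose v ([] , start) with start v
  ... | inj₁ (() , _)
  ... | inj₂ w = robberSurvivesZeroCops w

-- missing D ps counts the entries of ps that do not occur in D.  Recording a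
-- new element of ps in D strictly lowers it; this bounds the number of rounds
-- in which the robber can burn an edge.
module Missing {A : Set} (_≟_ : DecidableEquality A) where
  open import Data.List.Membership.DecPropositional _≟_ using (_∈?_)

  missing : List A → List A → ℕ
  missing D List.[] = 0
  missing D (p List.∷ ps) with p ∈? D
  ... | yes _ = missing D ps
  ... | no  _ = suc (missing D ps)

  missing-antitone : ∀ {D D'} → D ⊆ D' → ∀ ps → missing D' ps ≤ missing D ps
  missing-antitone sub List.[] = z≤n
  missing-antitone {D} {D'} sub (p List.∷ ps) with p ∈? D' | p ∈? D
  ... | yes _  | yes _ = missing-antitone sub ps
  ... | yes _  | no  _ = m≤n⇒m≤1+n (missing-antitone sub ps)
  ... | no p∉D' | yes p∈D = ⊥-elim (p∉D' (sub p∈D))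
  ... | no _   | no  _ = s≤s (missing-antitone sub ps)

  missing-strict : ∀ {D D' a} → D ⊆ D' → a ∉ D → a ∈ D' →
                   ∀ {ps} → a ∈ ps → missing D' ps < missing D ps
  missing-strict {D} {D'} sub a∉D a∈D' {p List.∷ ps} (here refl) with p ∈? D' | p ∈? D
  ... | _       | yes p∈D = ⊥-elim (a∉D p∈D)
  ... | no p∉D' | no _    = ⊥-elim (p∉D' a∈D')
  ... | yes _   | no _    = s≤s (missing-antitone sub ps)
  missing-strict {D} {D'} sub a∉D a∈D' {p List.∷ ps} (there a∈ps) with p ∈? D' | p ∈? D
  ... | yes _   | yes _   = missing-strict sub a∉D a∈D' a∈ps
  ... | yes _   | no _    = m≤n⇒m≤1+n (missing-strict sub a∉D a∈D' a∈ps)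
  ... | no p∉D' | yes p∈D = ⊥-elim (p∉D' (sub p∈D))
  ... | no _    | no _    = s≤s (missing-strict sub a∉D a∈D' a∈ps)

booleans : List Bool
booleans = true List.∷ false List.∷ List.[]

booleans-complete : ∀ b → b ∈ booleans
booleans-complete true  = here refl
booleans-complete false = there (here refl)

vertices : (n : ℕ) → List (Vec Bool n)
vertices zero    = [] List.∷ List.[]
vertices (suc n) = cartesianProductWith _∷_ booleans (vertices n)

vertices-complete : ∀ {n} (v : Vec Bool n) → v ∈ vertices n
vertices-complete []      = here refl
vertices-complete (b ∷ v) =
  ∈-cartesianProductWith⁺ _∷_ {xs = booleans} (booleans-complete b) (vertices-complete v)

pairEq : ∀ {n} → DecidableEquality (Vec Bool n × Vec Bool n)
pairEq = Product.≡-dec (≡-dec _≟ᵇ_) (≡-dec _≟ᵇ_)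

unburnt : ∀ {n} → List (Vec Bool n × Vec Bool n) → ℕ
unburnt {n} D = missing D (cartesianProduct (vertices n) (vertices n))
  where open Missing pairEq

unburnt-burn : ∀ {n} {D : List (Vec Bool n × Vec Bool n)} {a} → a ∉ D → unburnt (a List.∷ D) < unburnt D
unburnt-burn {a = u , v} a∉D =
  missing-strict there a∉D (here refl) (∈-cartesianProduct⁺ (vertices-complete u) (vertices-complete v))
  where open Missing pairEq

mismatch : Bool → Bool → ℕ
mismatch x y = if x xor y then 1 else 0

mismatch-positive : ∀ {x y} → x ≢ y → 1 ≤ mismatch x y
mismatch-positive {false} {false} x≢y = ⊥-elim (x≢y refl)
mismatch-positive {false} {true}  _   = ≤-refl
mismatch-positive {true}  {false} _   = ≤-refl
mismatch-positive {true}  {true}  x≢y = ⊥-elim (x≢y refl)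

mismatch-mono : ∀ {x y x' y'} → (x' ≢ y' → x ≢ y) → mismatch x' y' ≤ mismatch x y
mismatch-mono {x' = false} {false} _ = z≤n
mismatch-mono {x' = false} {true}  h = mismatch-positive (h (λ ()))
mismatch-mono {x' = true}  {false} h = mismatch-positive (h (λ ()))
mismatch-mono {x' = true}  {true}  _ = z≤n

mismatch-strict : ∀ {x y x' y'} → x ≢ y → x' ≡ y' → mismatch x' y' < mismatch x y
mismatch-strict {x' = false} x≢y refl = mismatch-positive x≢y
mismatch-strict {x' = true}  x≢y refl = mismatch-positive x≢y

Differ : ∀ {n} → Vec Bool n → Vec Bool n → Fin n → Set
Differ u v m = lookup u m ≢ lookup v m

differAt : ∀ {n} (u v : Vec Bool n) → u ≢ v → ∃ (Differ u v)
differAt [] [] u≢v = ⊥-elim (u≢v refl)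
differAt (x ∷ u) (y ∷ v) x∷u≢y∷v with x ≟ᵇ y
... | no x≢y = Fin.zero , x≢y
... | yes refl with differAt u v (x∷u≢y∷v ∘ cong (x ∷_))
...   | m , d = Fin.suc m , d

hamming-mono : ∀ {n} (u v u' v' : Vec Bool n) →
               (∀ m → Differ u' v' m → Differ u v m) → hamming u' v' ≤ hamming u v
hamming-mono [] [] [] [] _ = z≤n
hamming-mono (x ∷ u) (y ∷ v) (x' ∷ u') (y' ∷ v') sub =
  +-mono-≤ (mismatch-mono (sub Fin.zero)) (hamming-mono u v u' v' (sub ∘ Fin.suc))

hamming-strict : ∀ {n} (u v u' v' : Vec Bool n) →
                 (∀ m → Differ u' v' m → Differ u v m) →
                 ∀ k → Differ u v k → lookup u' k ≡ lookup v' k → hamming u' v' < hamming u v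
hamming-strict (x ∷ u) (y ∷ v) (x' ∷ u') (y' ∷ v') sub Fin.zero d a =
  +-mono-<-≤ (mismatch-strict d a) (hamming-mono u v u' v' (sub ∘ Fin.suc))
hamming-strict (x ∷ u) (y ∷ v) (x' ∷ u') (y' ∷ v') sub (Fin.suc k) d a =
  +-mono-≤-< (mismatch-mono (sub Fin.zero)) (hamming-strict u v u' v' (sub ∘ Fin.suc) k d a)

hamming-self : ∀ {n} (u : Vec Bool n) → hamming u u ≡ 0
hamming-self []          = refl
hamming-self (false ∷ u) = hamming-self u
hamming-self (true ∷ u)  = hamming-self u

hamming-zero : ∀ {n} (u v : Vec Bool n) → hamming u v ≡ 0 → u ≡ v
hamming-zero []          []          _ = refl
hamming-zero (false ∷ u) (false ∷ v) h = cong (false ∷_) (hamming-zero u v h)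
hamming-zero (true ∷ u)  (true ∷ v)  h = cong (true ∷_) (hamming-zero u v h)

toggle : ∀ {n} → Fin n → Vec Bool n → Vec Bool n
toggle j u = updateAt u j not

hamming-toggle : ∀ {n} (j : Fin n) (u : Vec Bool n) → hamming u (toggle j u) ≡ 1
hamming-toggle Fin.zero    (false ∷ u) = cong suc (hamming-self u)
hamming-toggle Fin.zero    (true ∷ u)  = cong suc (hamming-self u)
hamming-toggle (Fin.suc j) (false ∷ u) = hamming-toggle j u
hamming-toggle (Fin.suc j) (true ∷ u)  = hamming-toggle j u

adjacent-toggle : ∀ {n} (u v : Vec Bool n) → hamming u v ≡ 1 → ∃ λ j → v ≡ toggle j u
adjacent-toggle [] [] ()
adjacent-toggle (false ∷ u) (true ∷ v)  h = Fin.zero , cong (true ∷_) (sym (hamming-zero u v (cong pred h)))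
adjacent-toggle (true ∷ u)  (false ∷ v) h = Fin.zero , cong (false ∷_) (sym (hamming-zero u v (cong pred h)))
adjacent-toggle (false ∷ u) (false ∷ v) h with adjacent-toggle u v h
... | j , v≡ = Fin.suc j , cong (false ∷_) v≡
adjacent-toggle (true ∷ u)  (true ∷ v)  h with adjacent-toggle u v h
... | j , v≡ = Fin.suc j , cong (true ∷_) v≡

toggle-other : ∀ {n} {j m : Fin n} (u : Vec Bool n) → m ≢ j → lookup (toggle j u) m ≡ lookup u m
toggle-other {j = j} {m} u m≢j = lookup∘updateAt′ m j m≢j u

toggle-agrees : ∀ {n} {k : Fin n} (u v : Vec Bool n) → Differ u v k → lookup (toggle k u) k ≡ lookup v k
toggle-agrees {k = k} u v d = trans (lookup∘updateAt k u) (sym (¬-not (d ∘ sym)))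

toggle-narrows : ∀ {n} {k : Fin n} (u v : Vec Bool n) → Differ u v k →
                 ∀ m → Differ (toggle k u) v m → Differ u v m
toggle-narrows {k = k} u v d m d' with m ≟ᶠ k
... | yes refl = ⊥-elim (d' (toggle-agrees u v d))
... | no m≢k   = d' ∘ trans (toggle-other u m≢k)

toggle-both : ∀ {n} (k : Fin n) (u v : Vec Bool n) →
              ∀ m → Differ (toggle k u) (toggle k v) m → Differ u v m
toggle-both k u v m d' with m ≟ᶠ k
... | yes refl = λ e → d' (trans (lookup∘updateAt k u) (trans (cong not e) (sym (lookup∘updateAt k v))))
... | no m≢k   = λ e → d' (trans (toggle-other u m≢k) (trans e (sym (toggle-other v m≢k))))

record Follows {n} (c r c' r' : Vec Bool n) : Set where
  constructor following
  field
    follows : ∀ m → Differ c' r' m → Differ c r m × lookup r' m ≡ lookup r m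
open Follows

follows-hamming : ∀ {n} {c r c' r' : Vec Bool n} → Follows c r c' r' → hamming c' r' ≤ hamming c r
follows-hamming {c = c} {r} {c'} {r'} f = hamming-mono c r c' r' (λ m → proj₁ ∘ follows f m)

approach : ∀ {n} {k : Fin n} (c r : Vec Bool n) → Differ c r k → Follows c r (toggle k c) r
approach c r d = following λ m d' → toggle-narrows c r d m d' , refl

approach-closer : ∀ {n} {k : Fin n} (c r : Vec Bool n) → Differ c r k → hamming (toggle k c) r < hamming c r
approach-closer {k = k} c r d =
  hamming-strict c r (toggle k c) r (λ m → proj₁ ∘ follows (approach c r d) m) k d (toggle-agrees c r d)

chase : ∀ {n} (c r : Vec Bool n) (j : Fin n) → c ≢ toggle j r →
        ∃ λ k → Follows c r (toggle k c) (toggle j r)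
chase c r j c≢r' with lookup c j ≟ᵇ lookup r j
... | yes agree = j , following λ m d' →
  let d = toggle-both j c r m d'
      m≢j = λ { refl → d agree }
  in d , toggle-other r m≢j
... | no disagree with differAt c (toggle j r) c≢r'
...   | k , dk = k , following λ m d' →
  let d = toggle-narrows c (toggle j r) dk m d'
      m≢j = λ { refl → d (trans (¬-not disagree) (sym (lookup∘updateAt j r))) }
  in (d ∘ λ e → trans e (sym (toggle-other r m≢j))) , toggle-other r m≢j

module Pursuit (n : ℕ) where
  open Game (Q n)

  Vertex : Set
  Vertex = Vec Bool n

  _≡?_ : DecidableEquality Vertex
  _≡?_ = ≡-dec _≟ᵇ_

  Confined : Deleted → Vertex → Vertex → Set
  Confined D c r = ∀ {u v} → (u , v) ∈ D → ∀ m → Differ c r m →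
                   lookup u m ≡ lookup r m × lookup v m ≡ lookup r m

  Untouched : Deleted → Vertex → Set
  Untouched D c = ∀ v → (c , v) ∉ D × (v , c) ∉ D

  confined-untouched : ∀ {D c r} → Confined D c r → c ≢ r → Untouched D c
  confined-untouched {c = c} {r} conf c≢r v with differAt c r c≢r
  ... | k , d = (λ e → d (proj₁ (conf e k d))) , (λ e → d (proj₂ (conf e k d)))

  untouched-burn : ∀ {D c r r'} → Untouched D c → c ≢ r → c ≢ r' → Untouched ((r , r') List.∷ D) c
  untouched-burn {D} {c} {r} {r'} untouched c≢r c≢r' v = away , back
    where
      away : (c , v) ∉ ((r , r') List.∷ D)
      away (here refl) = c≢r refl
      away (there e)   = proj₁ (untouched v) e
      back : (v , c) ∉ ((r , r') List.∷ D)
      back (here refl) = c≢r' refl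
      back (there e)   = proj₂ (untouched v) e

  untouched-step : ∀ {D c} → Untouched D c → ∀ k → Present D c (toggle k c)
  untouched-step {c = c} untouched k =
    hamming-toggle k c , proj₁ (untouched (toggle k c)) , proj₂ (untouched (toggle k c))

  confined-follow : ∀ {D c r c' r'} → Confined D c r → Follows c r c' r' → Confined D c' r'
  confined-follow conf f e m d with follows f m d
  ... | dcr , same = trans (proj₁ (conf e m dcr)) (sym same) , trans (proj₂ (conf e m dcr)) (sym same)

  confined-burn : ∀ {D c r c' r'} → Confined D c r → Follows c r c' r' → Confined ((r , r') List.∷ D) c' r'
  confined-burn conf f (here refl) m d = sym (proj₂ (follows f m d)) , refl
  confined-burn conf f (there e)       = confined-follow conf f e

  potential : Deleted → Vertex → Vertex → ℕ
  potential D c r = unburnt D + hamming c r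

  RobberToMove : Deleted → Vertex → Vertex → Set
  RobberToMove D c r = ∀ r' D' → RMove D r r' D' → Captured [ c ] r' ⊎ CopWin D' [ c ] r'

  -- From a confined position with the robber to move, the cop catches him.
  -- 'catches' and 'moveTo' recurse mutually on the accessibility of the
  -- potential, which every full round lowers.
  catches : ∀ D c r → Acc _<_ (potential D c r) → Confined D c r → c ≢ r → RobberToMove D c r
  moveTo : ∀ {D c r} c' → StepOrStay D c c' → Acc _<_ (potential D c' r) → Confined D c' r →
           CopWin D [ c ] r

  catches D c r (acc smaller) conf c≢r .r .D stay with differAt c r c≢r
  ... | k , d = inj₂ (moveTo (toggle k c) (inj₂ (untouched-step (confined-untouched conf c≢r) k))
                        (smaller closer) (confined-follow conf (approach c r d)))
    where
      closer : potential D (toggle k c) r < potential D c r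
      closer = +-monoʳ-< (unburnt D) (approach-closer c r d)
  catches D c r (acc smaller) conf c≢r r' _ (go (adjacent , fresh , _)) with c ≡? r'
  ... | yes c≡r' = inj₁ (Fin.zero , c≡r')
  ... | no c≢r' with adjacent-toggle r r' adjacent
  ...   | j , refl with chase c r j c≢r'
  ...     | k , f = inj₂ (moveTo (toggle k c) (inj₂ step) (smaller closer) (confined-burn conf f))
    where
      step : Present ((r , toggle j r) List.∷ D) c (toggle k c)
      step = untouched-step (untouched-burn (confined-untouched conf c≢r) c≢r c≢r') k
      closer : potential ((r , toggle j r) List.∷ D) (toggle k c) (toggle j r) < potential D c r
      closer = +-mono-<-≤ (unburnt-burn fresh) (follows-hamming f)

  moveTo {D} {r = r} c' step accessible conf with c' ≡? r
  ... | yes c'≡r = win [ c' ] (λ { Fin.zero → step }) (inj₁ (Fin.zero , c'≡r))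
  ... | no c'≢r  = win [ c' ] (λ { Fin.zero → step }) (inj₂ (catches D c' r accessible conf c'≢r))

  origin : Vertex
  origin = replicate n false

  oneCopWins : CopsWin 1
  oneCopWins = [ origin ] , λ r →
    inj₂ (moveTo origin (inj₁ refl) (<-wellFounded _) (λ ()))

theorem4p12 : (n : ℕ) → 1 ≤ n → BridgeBurningCopNumberIs (Q n) 1
theorem4p12 n _ = Pursuit.oneCopWins n , fewerLose
  where
    fewerLose : ∀ k → k < 1 → ¬ Game.CopsWin (Q n) k
    fewerLose zero    _        = zeroCopsLose (Q n) (Pursuit.origin n)
    fewerLose (suc k) (s≤s ())
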